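{- If $S$ is a reflective numerical semigroup with genus $g(S)=g\ge1$ and multiplicity $m(S)=a$, then its Frobenius number is $F(S)=2g-r$, where $r$ is the unique integer in $\{1,\dots,a-1\}$ with $g\equiv r\pmod a$.
   Context: A numerical semigroup is a submonoid $S$ of $(\mathbb{N}_0,+)$ with finite complement; $g(S)=\#(\mathbb{N}_0\setminus S)$, $m(S)$ is the smallest positive element of $S$, and $F(S)$ is the largest element of $\mathbb{N}_0\setminus S$. $S$ (with $g=g(S)\ge1$) is reflective if for every integer $z$ with $0\le z\le g-1$ exactly one of $z$ and $z+g$ lies in $S$. (For reflective $S$ of positive genus, $a\nmid g$, so $r$ is well defined.) -}

module Defs where

open import Data.Nat using (ℕ; zero; suc; _+_; _*_; _<_; _≤_)
open import Data.List using (List; length)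
open import Data.List.Membership.Propositional using (_∈_)
open import Data.List.Relation.Unary.Unique.Propositional using (Unique)
open import Data.Product using (_×_; Σ)
open import Relation.Nullary using (¬_)
open import Relation.Binary.PropositionalEquality using (_≡_)
open import Data.Sum using (_⊎_)

Subset : Set₁
Subset = ℕ → Set

-- Submonoid of (ℕ₀,+) with finite complement.
-- The finite complement is witnessed by a duplicate-free list of exactly the gaps.
IsGapList : Subset → List ℕ → Set
IsGapList S gs = Unique gs × (∀ x → (x ∈ gs → ¬ S x) × (¬ S x → x ∈ gs))

record NumericalSemigroup : Set₁ where
  field
    member   : Subset
    zero∈    : member 0
    +-closed : ∀ x y → member x → member y → member (x + y)
    gaps     : List ℕ
    gapList  : IsGapList member gaps

open NumericalSemigroup public

genus : NumericalSemigroup → ℕ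
genus S = length (gaps S)

IsMultiplicity : NumericalSemigroup → ℕ → Set
IsMultiplicity S a = 0 < a × member S a × (∀ x → 0 < x → member S x → a ≤ x)

IsFrobenius : NumericalSemigroup → ℕ → Set
IsFrobenius S f = ¬ member S f × (∀ x → f < x → member S x)

Reflective : NumericalSemigroup → Set
Reflective S = ∀ z → z < genus S →
  (member S z × ¬ member S (z + genus S)) ⊎ (¬ member S z × member S (z + genus S))

-- Reflectivity puts exactly one gap in each pair {z, z + g} with z < g; these g gaps are
-- distinct, so they are all the gaps of S and every gap lies below 2g. Writing g = qa + r,
-- the multiple qa < g lies in S, so qa + g is a gap. For 0 < j < r the number j < a is a
-- gap, hence j + g ∈ S and qa + g + j ∈ S; so qa + g is the largest gap below
-- 2g = qa + g + r.
module Submission where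

open import Defs
open import Data.Nat using (ℕ; zero; suc; _+_; _*_; _<_; _≤_; _∸_; _≤?_; z<s)
open import Data.Nat.Properties
open import Algebra.Properties.CommutativeSemigroup +-commutativeSemigroup
  using (x∙yz≈xz∙y; xy∙z≈xz∙y)
open import Data.Fin using (Fin; toℕ)
open import Data.Fin.Properties using (injective⇒≤; toℕ<n; toℕ-injective)
open import Data.List using (List; length; lookup)
open import Data.List.Relation.Unary.Any using (index)
open import Data.List.Relation.Unary.Any.Properties using (lookup-index)
open import Data.List.Membership.Propositional using (_∈_)
open import Data.Product using (_×_; Σ; _,_; proj₁; proj₂)
open import Data.Sum using (_⊎_; inj₁; inj₂)
open import Function.Definitions using (Injective)
open import Relation.Nullary using (¬_; yes; no; contradiction)
open import Relation.Binary.PropositionalEquality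

∈-injective⇒≤-length : {A : Set} {m : ℕ} {xs : List A} (e : Fin m → A) →
  Injective _≡_ _≡_ e → (∀ i → e i ∈ xs) → m ≤ length xs
∈-injective⇒≤-length {xs = xs} e e-injective e∈xs = injective⇒≤ index-injective
  where
  index-injective : Injective _≡_ _≡_ (λ i → index (e∈xs i))
  index-injective {i} {j} same-index = e-injective (begin
    e i                         ≡⟨ lookup-index (e∈xs i) ⟩
    lookup xs (index (e∈xs i))  ≡⟨ cong (lookup xs) same-index ⟩
    lookup xs (index (e∈xs j))  ≡⟨ lookup-index (e∈xs j) ⟨
    e j                         ∎)
    where open ≡-Reasoning

ShiftPair : ℕ → ℕ → ℕ → Set
ShiftPair g i x = x ≡ i ⊎ x ≡ i + g

base-of-shift-pair : ∀ {g i j x} → i < g → j < g → ShiftPair g i x → ShiftPair g j x → i ≡ j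
base-of-shift-pair _   _   (inj₁ refl) (inj₁ x≡j) = x≡j
base-of-shift-pair {g} {j = j} i<g _ (inj₁ refl) (inj₂ refl) =
  contradiction (≤-trans i<g (m≤n+m g j)) (<-irrefl refl)
base-of-shift-pair {g} {i} _ j<g (inj₂ refl) (inj₁ refl) =
  contradiction (≤-trans j<g (m≤n+m g i)) (<-irrefl refl)
base-of-shift-pair {g} {i} {j} _ _ (inj₂ refl) (inj₂ i+g≡j+g) = +-cancelʳ-≡ g i j i+g≡j+g

shift-pair<2g : ∀ {g i x} → i < g → ShiftPair g i x → x < g + g
shift-pair<2g {g} i<g (inj₁ refl) = ≤-trans i<g (m≤m+n g g)
shift-pair<2g {g} i<g (inj₂ refl) = +-monoˡ-< g i<g

only-gap-in-window : {P : ℕ → Set} {lo r f : ℕ} → lo ≤ f → f < lo + r →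
  (∀ j → 0 < j → j < r → P (lo + j)) → ¬ P f → f ≡ lo
only-gap-in-window {P} {lo} {r} {f} lo≤f f<lo+r window f∉P with f ∸ lo | m+[n∸m]≡n lo≤f
... | zero  | lo+0≡f = trans (sym lo+0≡f) (+-identityʳ lo)
... | suc j | lo+j≡f = contradiction (subst P lo+j≡f (window (suc j) z<s j<r)) f∉P
  where
  j<r : suc j < r
  j<r = +-cancelˡ-< lo _ _ (subst (_< lo + r) (sym lo+j≡f) f<lo+r)

module _ (S : NumericalSemigroup) where

  multiple-∈ : ∀ {a} → member S a → ∀ k → member S (k * a)
  multiple-∈ a∈S zero    = zero∈ S
  multiple-∈ a∈S (suc k) = +-closed S _ _ a∈S (multiple-∈ a∈S k)

  below-multiplicity-gap : ∀ {a x} → IsMultiplicity S a → 0 < x → x < a → ¬ member S x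
  below-multiplicity-gap (_ , _ , minimal) 0<x x<a x∈S = <⇒≱ x<a (minimal _ 0<x x∈S)

  gap≤frobenius : ∀ {f x} → IsFrobenius S f → ¬ member S x → x ≤ f
  gap≤frobenius (_ , above-f∈S) x∉S = ≮⇒≥ (λ f<x → x∉S (above-f∈S _ f<x))

  module _ (reflective : Reflective S) where

    private
      g : ℕ
      g = genus S

    ∈⇒shift-gap : ∀ {z} → z < g → member S z → ¬ member S (z + g)
    ∈⇒shift-gap z<g z∈S with reflective _ z<g
    ... | inj₁ (_ , z+g∉S) = z+g∉S
    ... | inj₂ (z∉S , _)   = contradiction z∈S z∉S

    gap⇒shift-∈ : ∀ {z} → z < g → ¬ member S z → member S (z + g)
    gap⇒shift-∈ z<g z∉S with reflective _ z<g
    ... | inj₁ (z∈S , _)   = contradiction z∈S z∉S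
    ... | inj₂ (_ , z+g∈S) = z+g∈S

    reflected-gap : (i : Fin g) → Σ ℕ λ x → ¬ member S x × ShiftPair g (toℕ i) x
    reflected-gap i with reflective (toℕ i) (toℕ<n i)
    ... | inj₁ (_ , i+g∉S) = toℕ i + g , i+g∉S , inj₂ refl
    ... | inj₂ (i∉S , _)   = toℕ i , i∉S , inj₁ refl

    reflected-gap<2g : ∀ i → proj₁ (reflected-gap i) < g + g
    reflected-gap<2g i = shift-pair<2g (toℕ<n i) (proj₂ (proj₂ (reflected-gap i)))

    reflected-gap-injective : Injective _≡_ _≡_ (λ i → proj₁ (reflected-gap i))
    reflected-gap-injective {i} {j} same = toℕ-injective
      (base-of-shift-pair (toℕ<n i) (toℕ<n j)
        (proj₂ (proj₂ (reflected-gap i)))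
        (subst (ShiftPair g (toℕ j)) (sym same) (proj₂ (proj₂ (reflected-gap j)))))

    gap<2g : ∀ {x} → ¬ member S x → x < g + g
    gap<2g {x} x∉S with g + g ≤? x
    ... | no  2g≰x = ≰⇒> 2g≰x
    ... | yes 2g≤x =
      contradiction (∈-injective⇒≤-length gap gap-injective gap∈gaps) 1+n≰n
      where
      gap : Fin (suc g) → ℕ
      gap Fin.zero    = x
      gap (Fin.suc i) = proj₁ (reflected-gap i)

      reflected-gap≢x : ∀ i → proj₁ (reflected-gap i) ≢ x
      reflected-gap≢x i eq = <⇒≱ (reflected-gap<2g i) (subst (g + g ≤_) (sym eq) 2g≤x)

      gap-injective : Injective _≡_ _≡_ gap
      gap-injective {Fin.zero}  {Fin.zero}  _  = refl
      gap-injective {Fin.zero}  {Fin.suc j} eq = contradiction (sym eq) (reflected-gap≢x j)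
      gap-injective {Fin.suc i} {Fin.zero}  eq = contradiction eq (reflected-gap≢x i)
      gap-injective {Fin.suc i} {Fin.suc j} eq = cong Fin.suc (reflected-gap-injective eq)

      gap∈gaps : ∀ i → gap i ∈ gaps S
      gap∈gaps Fin.zero    = proj₂ (proj₂ (gapList S) x) x∉S
      gap∈gaps (Fin.suc i) = proj₂ (proj₂ (gapList S) _) (proj₁ (proj₂ (reflected-gap i)))

    frobenius≡multiple+genus : ∀ {a r f} → IsMultiplicity S a →
      ∀ q → g ≡ q * a + r → 0 < r → r ≤ a → IsFrobenius S f → f ≡ q * a + g
    frobenius≡multiple+genus {a} {r} {f} a-mult@(_ , a∈S , _) q g≡qa+r 0<r r≤a
                             frob@(f∉S , _) =
      only-gap-in-window {P = member S} (gap≤frobenius frob qa+g∉S) f<qa+g+r window f∉S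
      where
      qa∈S : member S (q * a)
      qa∈S = multiple-∈ a∈S q

      qa+g∉S : ¬ member S (q * a + g)
      qa+g∉S = ∈⇒shift-gap (subst (q * a <_) (sym g≡qa+r) (m<m+n (q * a) 0<r)) qa∈S

      f<qa+g+r : f < q * a + g + r
      f<qa+g+r =
        subst (f <_) (trans (cong (_+ g) g≡qa+r) (xy∙z≈xz∙y (q * a) r g)) (gap<2g f∉S)

      window : ∀ j → 0 < j → j < r → member S (q * a + g + j)
      window j 0<j j<r =
        subst (member S) (x∙yz≈xz∙y (q * a) j g) (+-closed S _ _ qa∈S j+g∈S)
        where
        j<g : j < g
        j<g = <-≤-trans j<r (subst (r ≤_) (sym g≡qa+r) (m≤n+m r (q * a)))

        j+g∈S : member S (j + g)
        j+g∈S = gap⇒shift-∈ j<g (below-multiplicity-gap a-mult 0<j (<-≤-trans j<r r≤a))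

corollary3p6 : (S : NumericalSemigroup) → Reflective S → 1 ≤ genus S →
    (a : ℕ) → IsMultiplicity S a →
    (r : ℕ) → 1 ≤ r → r ≤ a ∸ 1 → (Σ ℕ λ q → genus S ≡ q * a + r) →
    (f : ℕ) → IsFrobenius S f →
    f + r ≡ 2 * genus S
corollary3p6 S reflective _ a a-mult r 1≤r r≤a∸1 (q , g≡qa+r) f frob = begin
  f + r              ≡⟨ cong (_+ r) f≡qa+g ⟩
  q * a + g + r      ≡⟨ xy∙z≈xz∙y (q * a) r g ⟨
  (q * a + r) + g    ≡⟨ cong (_+ g) g≡qa+r ⟨
  g + g              ≡⟨ cong (g +_) (+-identityʳ g) ⟨
  2 * g              ∎
  where
  open ≡-Reasoning
  g : ℕ
  g = genus S
  f≡qa+g : f ≡ q * a + g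
  f≡qa+g = frobenius≡multiple+genus S reflective a-mult q g≡qa+r 1≤r
             (≤-trans r≤a∸1 (m∸n≤m a 1)) frob
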